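{- Let $v\geq 2$ and let $q$ be a prime power. Let $H\cong PG(v,q)$ be a hyperplane of $PG(v+1,q)$, let $B\subset H$ be a $v$-fold strong blocking set in $H$ of size $k$, let $P_1,\ldots,P_{v+1}$ be $v+1$ independent points of $H$, and let $l_1,\ldots,l_{v+1}$ be concurrent lines of $PG(v+1,q)$ with $l_i\cap H=\{P_i\}$ for each $i$. Then $$B^{\star}=B\cup\bigcup_{i=1}^{v+1}\bigl(l_i\setminus\{P_i\}\bigr)$$ is a $(v+1)$-fold strong blocking set in $PG(v+1,q)$ of size $k+1+(v+1)(q-1)$.
   Context: For $2\leq t\leq v$, a point set $B$ in $PG(v,q)$ is a $t$-fold strong blocking set if every $(t-1)$-dimensional subspace of $PG(v,q)$ is spanned by $t$ points of $B$. -}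

module Defs where

open import Level using (Level; _⊔_) renaming (suc to lsuc)
open import Data.Nat using (ℕ; zero; suc; _≤_; _^_)
open import Data.Nat.Primality using (Prime)
open import Data.Fin using (Fin; suc)
import Data.Fin as Fin
open import Data.List using (List; length; lookup)
open import Data.List.Relation.Unary.All using (All)
open import Data.List.Relation.Unary.Any using (Any)
open import Data.List.Relation.Unary.AllPairs using (AllPairs)
open import Data.Product using (Σ; ∃; _×_; _,_)
open import Data.Unit.Polymorphic using (⊤)
open import Algebra.Bundles using (CommutativeRing)
open import Relation.Nullary using (¬_)
open import Relation.Binary.PropositionalEquality using (_≡_)

record Field (c ℓ : Level) : Set (lsuc (c ⊔ ℓ)) where
  field
    commutativeRing : CommutativeRing c ℓ
  open CommutativeRing commutativeRing public
  field
    1≉0     : ¬ (1# ≈ 0#)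
    inverse : ∀ x → ¬ (x ≈ 0#) → ∃ λ y → (x * y) ≈ 1#

PrimePower : ℕ → Set
PrimePower q = ∃ λ p → ∃ λ e → Prime p × 1 ≤ e × q ≡ p ^ e

HasOrder : ∀ {c ℓ} → Field c ℓ → ℕ → Set (c ⊔ ℓ)
HasOrder F q =
  ∃ λ (els : List Carrier) →
    length els ≡ q × AllPairs (λ x y → ¬ (x ≈ y)) els × (∀ x → Any (x ≈_) els)
  where open Field F

-- Projective geometry PG(n-1, F): points are nonzero vectors of F^n up to
-- nonzero scalars.
module Geometry {c ℓ} (F : Field c ℓ) where
  open Field F using (Carrier; _≈_; _+_; _*_; 0#)

  Vec : ℕ → Set c
  Vec n = Fin n → Carrier

  IsPoint : ∀ {n} → Vec n → Set ℓ
  IsPoint x = ¬ (∀ i → x i ≈ 0#)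

  _∼_ : ∀ {n} → Vec n → Vec n → Set (c ⊔ ℓ)
  x ∼ y = ∃ λ μ → ¬ (μ ≈ 0#) × (∀ i → x i ≈ (μ * y i))

  sumF : ∀ t → (Fin t → Carrier) → Carrier
  sumF zero    f = 0#
  sumF (suc t) f = f Fin.zero + sumF t (λ j → f (suc j))

  lincomb : ∀ {t n} → (Fin t → Carrier) → (Fin t → Vec n) → Vec n
  lincomb {t} cs u i = sumF t (λ j → cs j * u j i)

  _∈Span_ : ∀ {t n} → Vec n → (Fin t → Vec n) → Set (c ⊔ ℓ)
  x ∈Span u = ∃ λ cs → ∀ i → x i ≈ lincomb cs u i

  Independent : ∀ {t n} → (Fin t → Vec n) → Set (c ⊔ ℓ)
  Independent {t} u = ∀ cs → (∀ i → lincomb cs u i ≈ 0#) → ∀ j → cs j ≈ 0#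

  SameSpan : ∀ {s t n} → (Fin s → Vec n) → (Fin t → Vec n) → Set (c ⊔ ℓ)
  SameSpan u w = (∀ i → u i ∈Span w) × (∀ j → w j ∈Span u)

  InHyp : ∀ {n} → Vec n → Vec n → Set ℓ
  InHyp {n} a x = sumF n (λ i → a i * x i) ≈ 0#

  -- a finite point set, given by a list of representatives
  ValidPointSet : ∀ {n} → List (Vec n) → Set (c ⊔ ℓ)
  ValidPointSet L = All IsPoint L × AllPairs (λ x y → ¬ (x ∼ y)) L

  _∈pt_ : ∀ {n} → Vec n → List (Vec n) → Set (c ⊔ ℓ)
  x ∈pt L = Any (x ∼_) L

  -- Every (t-1)-dimensional projective subspace contained in the ambient
  -- space W (a t-dimensional linear subspace with all vectors in W, given
  -- by t independent vectors) is spanned by t points of L.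
  StrongBlockingIn : ∀ {n} {w} → (Vec n → Set w) → ℕ → List (Vec n) → Set (c ⊔ ℓ ⊔ w)
  StrongBlockingIn W t L =
    ∀ (u : Fin t → Vec _) → Independent u → (∀ i → W (u i)) →
      ∃ λ (f : Fin t → Fin (length L)) → SameSpan (λ j → lookup L (f j)) u

  StrongBlocking : ∀ {n} → ℕ → List (Vec n) → Set (c ⊔ ℓ)
  StrongBlocking {n} t L = StrongBlockingIn {n} {Level.zero} (λ _ → ⊤) t L

module Submission where

-- Let H = {a·x = 0}. The common point Q of the lines lᵢ is not in H, so the points of
-- lᵢ other than Pᵢ are Q and the Pᵢ + tQ with t ≠ 0; they are pairwise distinct and,
-- lying off H, distinct from the points of B. Now let U be a hyperplane, spanned by
-- independent u₀,…,u_v. If U = H, the blocking property of B applied to two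
-- hyperplanes of H, each spanned by v of the Pᵢ, yields v + 1 points of B spanning H.
-- Otherwise U ∩ H is a hyperplane of H, spanned by v points of B. The independent
-- P₀,…,P_v cannot all lie in U ∩ H, so some plane ⟨Q, Pᵢ⟩ meets U in a point z ∉ H;
-- then z lies on lᵢ ∖ {Pᵢ} ⊆ B⋆ and, with those v points of B, spans U.

open import Level using (_⊔_)
open import Algebra.Bundles using (CommutativeRing)
open import Data.Nat as ℕ using (ℕ; zero; suc; _≤_; s≤s; z≤n)
import Data.Nat.Properties as ℕₚ
import Data.Integer as ℤ
open import Data.Fin as Fin using (Fin; zero; suc; punchIn; punchOut; remQuot; combine)
open import Data.Fin.Properties
  using (all?; ¬∀⟶∃¬; punchIn-punchOut; punchInᵢ≢i; punchIn-injective; combine-remQuot; remQuot-combine)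
open import Data.Vec.Functional using (_∷_; []; insertAt)
open import Data.Vec.Functional.Properties using (insertAt-lookup; insertAt-punchIn)
open import Data.List using (List; length; lookup; _++_; tabulate)
import Data.List as List
import Data.List.Properties as Listₚ
open import Data.List.Relation.Unary.All as All using (All)
import Data.List.Relation.Unary.All.Properties as Allₚ
open import Data.List.Relation.Unary.AllPairs as AllPairs using (AllPairs)
import Data.List.Relation.Unary.AllPairs.Properties as AllPairsₚ
open import Data.List.Relation.Unary.Any as Any using (Any; here; there; index)
import Data.List.Relation.Unary.Any.Properties as Anyₚ
open import Data.List.Membership.Propositional.Properties using (∈-lookup)
open import Data.Product using (∃; ∃₂; _×_; _,_; proj₁; proj₂)
open import Data.Sum using (_⊎_; inj₁; inj₂; [_,_]′)
open import Function using (_∘_)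
open import Function.Bundles using (_⇔_; mk⇔; Equivalence)
open import Relation.Nullary using (¬_; Dec; yes; no)
open import Relation.Nullary.Decidable using (map′)
open import Relation.Nullary.Negation using (contradiction)
open import Relation.Binary.PropositionalEquality using (_≡_; _≢_)
import Relation.Binary.PropositionalEquality as ≡
open import Defs

module IntegerRingSolver {c ℓ} (R : CommutativeRing c ℓ) where
  open import Data.Integer using (ℤ; +_; -[1+_]; _⊖_)
  import Data.Integer.Properties as ℤₚ
  open import Data.Sign as Sign using (Sign)
  open import Data.Maybe using (Maybe; just; nothing)
  open import Algebra.Solver.Ring.AlmostCommutativeRing
    using (_-Raw-AlmostCommutative⟶_; fromCommutativeRing)

  open CommutativeRing R hiding (zero)
  open import Algebra.Properties.Ring ring using (-0#≈0#; -‿involutive; -1*x≈-x; ⁻¹-anti-homo‿-; -‿+-comm)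
  open import Algebra.Properties.Semiring.Mult semiring using (×-homo-+; ×1-homo-*) renaming (_×_ to _·_)
  open import Relation.Binary.Reasoning.Setoid setoid

  ⟦_⟧ℤ : ℤ → Carrier
  ⟦ + n ⟧ℤ      = n · 1#
  ⟦ -[1+ n ] ⟧ℤ = - (suc n · 1#)

  -‿homo : ∀ i → ⟦ ℤ.- i ⟧ℤ ≈ - ⟦ i ⟧ℤ
  -‿homo (+ zero)   = sym -0#≈0#
  -‿homo (+ suc n)  = refl
  -‿homo -[1+ n ]   = sym (-‿involutive _)

  ∸-homo : ∀ {m n} → n ℕ.≤ m → (m ℕ.∸ n) · 1# ≈ m · 1# - n · 1#
  ∸-homo {m} {n} n≤m = begin
    (m ℕ.∸ n) · 1#                          ≈⟨ +-identityʳ _ ⟨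
    (m ℕ.∸ n) · 1# + 0#                     ≈⟨ +-congˡ (-‿inverseʳ (n · 1#)) ⟨
    (m ℕ.∸ n) · 1# + (n · 1# - n · 1#)      ≈⟨ +-assoc _ _ _ ⟨
    ((m ℕ.∸ n) · 1# + n · 1#) - n · 1#      ≈⟨ +-congʳ (×-homo-+ 1# (m ℕ.∸ n) n) ⟨
    (m ℕ.∸ n ℕ.+ n) · 1# - n · 1#           ≡⟨ ≡.cong (λ k → k · 1# - n · 1#) (ℕₚ.m∸n+n≡m n≤m) ⟩
    m · 1# - n · 1#                          ∎

  ⊖-homo : ∀ m n → ⟦ m ⊖ n ⟧ℤ ≈ m · 1# - n · 1#
  ⊖-homo m n with ℕₚ.≤-total n m
  ... | inj₁ n≤m = trans (reflexive (≡.cong ⟦_⟧ℤ (ℤₚ.⊖-≥ n≤m))) (∸-homo n≤m)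
  ... | inj₂ m≤n = begin
    ⟦ m ⊖ n ⟧ℤ                   ≡⟨ ≡.cong ⟦_⟧ℤ (ℤₚ.⊖-≤ m≤n) ⟩
    ⟦ ℤ.- + (n ℕ.∸ m) ⟧ℤ         ≈⟨ -‿homo (+ (n ℕ.∸ m)) ⟩
    - ((n ℕ.∸ m) · 1#)           ≈⟨ -‿cong (∸-homo m≤n) ⟩
    - (n · 1# - m · 1#)          ≈⟨ ⁻¹-anti-homo‿- _ _ ⟩
    m · 1# - n · 1#              ∎

  +-homo : ∀ i j → ⟦ i ℤ.+ j ⟧ℤ ≈ ⟦ i ⟧ℤ + ⟦ j ⟧ℤ
  +-homo -[1+ m ] -[1+ n ] = begin
    - (suc (suc (m ℕ.+ n)) · 1#)         ≡⟨ ≡.cong (λ k → - (suc k · 1#)) (ℕₚ.+-suc m n) ⟨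
    - ((suc m ℕ.+ suc n) · 1#)           ≈⟨ -‿cong (×-homo-+ 1# (suc m) (suc n)) ⟩
    - (suc m · 1# + suc n · 1#)          ≈⟨ -‿+-comm _ _ ⟨
    - (suc m · 1#) + - (suc n · 1#)      ∎
  +-homo -[1+ m ] (+ n)    = trans (⊖-homo n (suc m)) (+-comm _ _)
  +-homo (+ m)    -[1+ n ] = ⊖-homo m (suc n)
  +-homo (+ m)    (+ n)    = ×-homo-+ 1# m n

  sign-homo : Sign → Carrier
  sign-homo Sign.+ = 1#
  sign-homo Sign.- = - 1#

  sign-homo-* : ∀ s t → sign-homo (s Sign.* t) ≈ sign-homo s * sign-homo t
  sign-homo-* Sign.- Sign.- = sym (trans (-1*x≈-x _) (-‿involutive _))
  sign-homo-* Sign.- Sign.+ = sym (*-identityʳ _)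
  sign-homo-* Sign.+ Sign.- = sym (*-identityˡ _)
  sign-homo-* Sign.+ Sign.+ = sym (*-identityˡ _)

  ◃-homo : ∀ s n → ⟦ s ℤ.◃ n ⟧ℤ ≈ sign-homo s * (n · 1#)
  ◃-homo Sign.- zero    = sym (zeroʳ _)
  ◃-homo Sign.+ zero    = sym (zeroʳ _)
  ◃-homo Sign.- (suc n) = sym (-1*x≈-x _)
  ◃-homo Sign.+ (suc n) = sym (*-identityˡ _)

  sign-abs : ∀ i → ⟦ i ⟧ℤ ≈ sign-homo (ℤ.sign i) * (ℤ.∣ i ∣ · 1#)
  sign-abs i = trans (reflexive (≡.cong ⟦_⟧ℤ (≡.sym (ℤₚ.◃-inverse i)))) (◃-homo (ℤ.sign i) ℤ.∣ i ∣)

  *-interchange : ∀ a b x y → (a * b) * (x * y) ≈ (a * x) * (b * y)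
  *-interchange a b x y = begin
    (a * b) * (x * y)  ≈⟨ *-assoc _ _ _ ⟩
    a * (b * (x * y))  ≈⟨ *-congˡ (x∙yz≈y∙xz b x y) ⟩
    a * (x * (b * y))  ≈⟨ *-assoc _ _ _ ⟨
    (a * x) * (b * y)  ∎
    where open import Algebra.Properties.CommutativeSemigroup *-commutativeSemigroup using (x∙yz≈y∙xz)

  *-homo : ∀ i j → ⟦ i ℤ.* j ⟧ℤ ≈ ⟦ i ⟧ℤ * ⟦ j ⟧ℤ
  *-homo i j = begin
    ⟦ i ℤ.* j ⟧ℤ
      ≈⟨ ◃-homo (s Sign.* t) (m ℕ.* n) ⟩
    sign-homo (s Sign.* t) * ((m ℕ.* n) · 1#)
      ≈⟨ *-cong (sign-homo-* s t) (×1-homo-* m n) ⟩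
    (sign-homo s * sign-homo t) * ((m · 1#) * (n · 1#))
      ≈⟨ *-interchange _ _ _ _ ⟩
    (sign-homo s * (m · 1#)) * (sign-homo t * (n · 1#))
      ≈⟨ *-cong (sign-abs i) (sign-abs j) ⟨
    ⟦ i ⟧ℤ * ⟦ j ⟧ℤ ∎
    where
    s t : Sign
    s = ℤ.sign i
    t = ℤ.sign j
    m n : ℕ
    m = ℤ.∣ i ∣
    n = ℤ.∣ j ∣

  ℤ⟶R : ℤ.+-*-rawRing -Raw-AlmostCommutative⟶ fromCommutativeRing R
  ℤ⟶R = record
    { ⟦_⟧ = ⟦_⟧ℤ ; +-homo = +-homo ; *-homo = *-homo ; -‿homo = -‿homo
    ; 0-homo = refl ; 1-homo = +-identityʳ 1# }

  ≟-witness : ∀ i j → Maybe (⟦ i ⟧ℤ ≈ ⟦ j ⟧ℤ)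
  ≟-witness i j with i ℤ.≟ j
  ... | yes ≡.refl = just refl
  ... | no _       = nothing

  open import Algebra.Solver.Ring ℤ.+-*-rawRing (fromCommutativeRing R) ℤ⟶R ≟-witness public

module LinearAlgebra {c ℓ} (F : Field c ℓ) where
  open Field F hiding (zero)
  open Geometry F
  open IntegerRingSolver commutativeRing using (solve; _:=_; _:+_; _:*_; :-_; con)
  open import Algebra.Properties.Ring ring using (-0#≈0#; -‿distribˡ-*; -1*x≈-x; -‿involutive; x∙y⁻¹≈ε⇒x≈y)
  open import Relation.Binary.Reasoning.Setoid setoid

  inv : ∀ x → ¬ x ≈ 0# → Carrier
  inv x x≉0 = proj₁ (inverse x x≉0)

  *-inverseʳ : ∀ x (x≉0 : ¬ x ≈ 0#) → x * inv x x≉0 ≈ 1#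
  *-inverseʳ x x≉0 = proj₂ (inverse x x≉0)

  x*y≈0⇒y≈0 : ∀ {x y} → ¬ x ≈ 0# → x * y ≈ 0# → y ≈ 0#
  x*y≈0⇒y≈0 {x} {y} x≉0 xy≈0 = begin
    y                ≈⟨ *-identityˡ y ⟨
    1# * y           ≈⟨ *-congʳ (*-inverseʳ x x≉0) ⟨
    (x * x⁻¹) * y    ≈⟨ solve 3 (λ x x⁻¹ y → (x :* x⁻¹) :* y := x⁻¹ :* (x :* y)) refl x x⁻¹ y ⟩
    x⁻¹ * (x * y)    ≈⟨ *-congˡ xy≈0 ⟩
    x⁻¹ * 0#         ≈⟨ zeroʳ x⁻¹ ⟩
    0#               ∎
    where
    x⁻¹ : Carrier
    x⁻¹ = inv x x≉0

  x*y≈0⇒x≈0 : ∀ {x y} → ¬ y ≈ 0# → x * y ≈ 0# → x ≈ 0#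
  x*y≈0⇒x≈0 y≉0 xy≈0 = x*y≈0⇒y≈0 y≉0 (trans (*-comm _ _) xy≈0)

  *-≉0 : ∀ {x y} → ¬ x ≈ 0# → ¬ y ≈ 0# → ¬ x * y ≈ 0#
  *-≉0 x≉0 y≉0 xy≈0 = y≉0 (x*y≈0⇒y≈0 x≉0 xy≈0)

  inv-≉0 : ∀ x (x≉0 : ¬ x ≈ 0#) → ¬ inv x x≉0 ≈ 0#
  inv-≉0 x x≉0 x⁻¹≈0 = 1≉0 (trans (sym (*-inverseʳ x x≉0)) (trans (*-congˡ x⁻¹≈0) (zeroʳ x)))

  ≉0-resp-≈ : ∀ {x y} → x ≈ y → ¬ x ≈ 0# → ¬ y ≈ 0#
  ≉0-resp-≈ x≈y x≉0 y≈0 = x≉0 (trans x≈y y≈0)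

  x≈0⇒x*y≈0 : ∀ {x} y → x ≈ 0# → x * y ≈ 0#
  x≈0⇒x*y≈0 y x≈0 = trans (*-congʳ x≈0) (zeroˡ y)

  *-cancelʳ-≉0 : ∀ {x y z} → ¬ z ≈ 0# → x * z ≈ y * z → x ≈ y
  *-cancelʳ-≉0 {x} {y} {z} z≉0 xz≈yz = x∙y⁻¹≈ε⇒x≈y x y (x*y≈0⇒x≈0 z≉0 (begin
    (x - y) * z        ≈⟨ solve 3 (λ x y z → (x :+ :- y) :* z := x :* z :+ :- (y :* z)) refl x y z ⟩
    x * z - y * z      ≈⟨ +-congʳ xz≈yz ⟩
    y * z - y * z      ≈⟨ -‿inverseʳ (y * z) ⟩
    0#                 ∎))

  -1≉0 : ¬ - 1# ≈ 0#
  -1≉0 -1≈0 = 1≉0 (trans (sym (-‿involutive 1#)) (trans (-‿cong -1≈0) -0#≈0#))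

  solve-linear : ∀ {a x y} (a≉0 : ¬ a ≈ 0#) → a * x + y ≈ 0# → x ≈ (- inv a a≉0) * y
  solve-linear {a} {x} {y} a≉0 ax+y≈0 = begin
    x                          ≈⟨ *-identityʳ x ⟨
    x * 1#                     ≈⟨ *-congˡ (*-inverseʳ a a≉0) ⟨
    x * (a * a⁻¹)              ≈⟨ solve 4 (λ x a a⁻¹ y → x :* (a :* a⁻¹) := a⁻¹ :* (a :* x :+ y) :+ (:- a⁻¹) :* y) refl x a a⁻¹ y ⟩
    a⁻¹ * (a * x + y) + (- a⁻¹) * y ≈⟨ +-congʳ (trans (*-congˡ ax+y≈0) (zeroʳ a⁻¹)) ⟩
    0# + (- a⁻¹) * y           ≈⟨ +-identityˡ _ ⟩
    (- a⁻¹) * y                ∎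
    where
    a⁻¹ : Carrier
    a⁻¹ = inv a a≉0

  sumF-cong : ∀ t {f g : Fin t → Carrier} → (∀ j → f j ≈ g j) → sumF t f ≈ sumF t g
  sumF-cong zero    f≈g = refl
  sumF-cong (suc t) f≈g = +-cong (f≈g zero) (sumF-cong t (f≈g ∘ suc))

  sumF-zero : ∀ t {f : Fin t → Carrier} → (∀ j → f j ≈ 0#) → sumF t f ≈ 0#
  sumF-zero zero    f≈0 = refl
  sumF-zero (suc t) f≈0 = trans (+-cong (f≈0 zero) (sumF-zero t (f≈0 ∘ suc))) (+-identityˡ 0#)

  sumF-+ : ∀ t (f g : Fin t → Carrier) → sumF t (λ j → f j + g j) ≈ sumF t f + sumF t g
  sumF-+ zero    f g = sym (+-identityˡ 0#)
  sumF-+ (suc t) f g = trans (+-congˡ (sumF-+ t (f ∘ suc) (g ∘ suc)))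
    (solve 4 (λ a b x y → (a :+ b) :+ (x :+ y) := (a :+ x) :+ (b :+ y)) refl
      (f zero) (g zero) (sumF t (f ∘ suc)) (sumF t (g ∘ suc)))

  sumF-*ˡ : ∀ t x (f : Fin t → Carrier) → sumF t (λ j → x * f j) ≈ x * sumF t f
  sumF-*ˡ zero    x f = sym (zeroʳ x)
  sumF-*ˡ (suc t) x f = trans (+-congˡ (sumF-*ˡ t x (f ∘ suc))) (sym (distribˡ _ _ _))

  sumF-*ʳ : ∀ t x (f : Fin t → Carrier) → sumF t (λ j → f j * x) ≈ sumF t f * x
  sumF-*ʳ t x f = trans (sumF-cong t (λ j → *-comm (f j) x)) (trans (sumF-*ˡ t x f) (*-comm x _))

  sumF-comm : ∀ s t (f : Fin s → Fin t → Carrier) →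
    sumF s (λ i → sumF t (f i)) ≈ sumF t (λ j → sumF s (λ i → f i j))
  sumF-comm zero    t f = sym (sumF-zero t (λ _ → refl))
  sumF-comm (suc s) t f = trans (+-congˡ (sumF-comm s t (f ∘ suc))) (sym (sumF-+ t (f zero) _))

  sumF-punchIn : ∀ t p (f : Fin (suc t) → Carrier) → sumF (suc t) f ≈ f p + sumF t (f ∘ punchIn p)
  sumF-punchIn t       zero    f = refl
  sumF-punchIn (suc t) (suc p) f = trans (+-congˡ (sumF-punchIn t p (f ∘ suc)))
    (solve 3 (λ a b x → a :+ (b :+ x) := b :+ (a :+ x)) refl
      (f zero) (f (suc p)) (sumF t (f ∘ suc ∘ punchIn p)))

  infixl 6 _+ᵥ_
  infixr 7 _*ᵥ_

  _+ᵥ_ : ∀ {n} → Vec n → Vec n → Vec n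
  (x +ᵥ y) i = x i + y i

  _*ᵥ_ : ∀ {n} → Carrier → Vec n → Vec n
  (μ *ᵥ x) i = μ * x i

  lincomb-+ : ∀ {t n} (cs ds : Fin t → Carrier) (u : Fin t → Vec n) i →
    lincomb (λ j → cs j + ds j) u i ≈ lincomb cs u i + lincomb ds u i
  lincomb-+ {t} cs ds u i = trans (sumF-cong t (λ j → distribʳ (u j i) (cs j) (ds j))) (sumF-+ t _ _)

  lincomb-* : ∀ {t n} μ (cs : Fin t → Carrier) (u : Fin t → Vec n) i →
    lincomb (λ j → μ * cs j) u i ≈ μ * lincomb cs u i
  lincomb-* {t} μ cs u i = trans (sumF-cong t (λ j → *-assoc μ (cs j) (u j i))) (sumF-*ˡ t μ _)

  lincomb-zero : ∀ {t n} {cs : Fin t → Carrier} (u : Fin t → Vec n) → (∀ j → cs j ≈ 0#) → ∀ i →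
    lincomb cs u i ≈ 0#
  lincomb-zero {t} u cs≈0 i = sumF-zero t (λ j → x≈0⇒x*y≈0 (u j i) (cs≈0 j))

  lincomb-congʳ : ∀ {t n} (cs : Fin t → Carrier) {u w : Fin t → Vec n} → (∀ k i → u k i ≈ w k i) → ∀ i →
    lincomb cs u i ≈ lincomb cs w i
  lincomb-congʳ {t} cs u≈w i = sumF-cong t (λ k → *-congˡ (u≈w k i))

  lincomb-insertAt : ∀ {t n} (cs : Fin t → Carrier) p e (u : Fin (suc t) → Vec n) i →
    lincomb (insertAt cs p e) u i ≈ e * u p i + lincomb cs (u ∘ punchIn p) i
  lincomb-insertAt {t} cs p e u i = trans (sumF-punchIn t p (λ j → insertAt cs p e j * u j i))
    (+-cong (reflexive (≡.cong (_* u p i) (insertAt-lookup cs p e)))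
            (sumF-cong t (λ k → reflexive (≡.cong (_* u (punchIn p k) i) (insertAt-punchIn cs p e k)))))

  lincomb-lincomb : ∀ {s t n} (cs : Fin s → Carrier) (ds : Fin s → Fin t → Carrier) (g : Fin t → Vec n) i →
    lincomb cs (λ k → lincomb (ds k) g) i ≈ lincomb (λ j → sumF s (λ k → cs k * ds k j)) g i
  lincomb-lincomb {s} {t} cs ds g i = begin
    sumF s (λ k → cs k * sumF t (λ j → ds k j * g j i))
      ≈⟨ sumF-cong s (λ k → sym (sumF-*ˡ t (cs k) _)) ⟩
    sumF s (λ k → sumF t (λ j → cs k * (ds k j * g j i)))
      ≈⟨ sumF-comm s t _ ⟩
    sumF t (λ j → sumF s (λ k → cs k * (ds k j * g j i)))
      ≈⟨ sumF-cong t (λ j → trans (sumF-cong s (λ k → sym (*-assoc (cs k) (ds k j) (g j i)))) (sumF-*ʳ s (g j i) _)) ⟩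
    sumF t (λ j → sumF s (λ k → cs k * ds k j) * g j i) ∎

  unit : ∀ {t} → Fin (suc t) → Fin (suc t) → Carrier
  unit k = insertAt (λ _ → 0#) k 1#

  lincomb-unit : ∀ {t n} (u : Fin (suc t) → Vec n) k i → lincomb (unit k) u i ≈ u k i
  lincomb-unit u k i = trans (lincomb-insertAt (λ _ → 0#) k 1# u i)
    (trans (+-cong (*-identityˡ _) (lincomb-zero (u ∘ punchIn k) (λ _ → refl) i)) (+-identityʳ _))

  unit-≢ : ∀ {t} {j i : Fin (suc t)} → j ≢ i → unit j i ≈ 0#
  unit-≢ {j = j} j≢i = reflexive (≡.trans (≡.cong (unit j) (≡.sym (punchIn-punchOut j≢i)))
                                          (insertAt-punchIn (λ _ → 0#) j 1# (punchOut j≢i)))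

  ∈Span-resp : ∀ {t n} {x y : Vec n} {u : Fin t → Vec n} → (∀ i → x i ≈ y i) → y ∈Span u → x ∈Span u
  ∈Span-resp x≈y (cs , y≈) = cs , λ i → trans (x≈y i) (y≈ i)

  ∈Span-+ : ∀ {t n} {x y : Vec n} (u : Fin t → Vec n) → x ∈Span u → y ∈Span u → (x +ᵥ y) ∈Span u
  ∈Span-+ u (cs , x≈) (ds , y≈) = (λ j → cs j + ds j) , λ i → trans (+-cong (x≈ i) (y≈ i)) (sym (lincomb-+ cs ds u i))

  ∈Span-* : ∀ {t n} μ {x : Vec n} (u : Fin t → Vec n) → x ∈Span u → (μ *ᵥ x) ∈Span u
  ∈Span-* μ u (cs , x≈) = (λ j → μ * cs j) , λ i → trans (*-congˡ (x≈ i)) (sym (lincomb-* μ cs u i))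

  ∈Span-trans : ∀ {s t n} {x : Vec n} {y : Fin s → Vec n} {g : Fin t → Vec n} →
    x ∈Span y → (∀ k → y k ∈Span g) → x ∈Span g
  ∈Span-trans {g = g} (cs , x≈) y⊆g = _ , λ i →
    trans (x≈ i) (trans (lincomb-congʳ cs (proj₂ ∘ y⊆g) i) (lincomb-lincomb cs (proj₁ ∘ y⊆g) g i))

  ∈Span-member : ∀ {t n} (u : Fin t → Vec n) k → u k ∈Span u
  ∈Span-member {suc t} u k = unit k , λ i → sym (lincomb-unit u k i)

  ∈Span-∷ : ∀ {t n} {x : Vec n} (z : Vec n) (b : Fin t → Vec n) → x ∈Span b → x ∈Span (z ∷ b)
  ∈Span-∷ z b (cs , x≈) = (0# ∷ cs) , λ i → trans (x≈ i) (trans (sym (+-identityˡ _)) (+-congʳ (sym (zeroˡ (z i)))))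

  ∈Span-∷-zero : ∀ {t n} {x z : Vec n} {w : Fin t → Vec n} cs → (∀ i → x i ≈ lincomb cs (z ∷ w) i) →
    cs zero ≈ 0# → x ∈Span w
  ∈Span-∷-zero {z = z} cs x≈ c₀≈0 = cs ∘ suc , λ i → trans (x≈ i) (trans (+-congʳ (x≈0⇒x*y≈0 (z i) c₀≈0)) (+-identityˡ _))

  ∈Span-exchange : ∀ {t n} {x z : Vec n} {w : Fin t → Vec n} cs → (∀ i → x i ≈ lincomb cs (z ∷ w) i) →
    ¬ cs zero ≈ 0# → z ∈Span (x ∷ w)
  ∈Span-exchange {n = n} {x = x} {z} {w} cs x≈ κ≉0 = (κ⁻¹ ∷ λ k → (- κ⁻¹) * cs (suc k)) , λ i → begin
    z i                           ≈⟨ solve-linear κ≉0 (relation i) ⟩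
    (- κ⁻¹) * (L i - x i)         ≈⟨ solve 3 (λ a L x → (:- a) :* (L :+ :- x) := a :* x :+ (:- a) :* L) refl κ⁻¹ (L i) (x i) ⟩
    κ⁻¹ * x i + (- κ⁻¹) * L i     ≈⟨ +-congˡ (lincomb-* (- κ⁻¹) (cs ∘ suc) w i) ⟨
    lincomb (κ⁻¹ ∷ λ k → (- κ⁻¹) * cs (suc k)) (x ∷ w) i ∎
    where
    κ κ⁻¹ : Carrier
    κ = cs zero
    κ⁻¹ = inv κ κ≉0
    L : Vec n
    L = lincomb (cs ∘ suc) w
    relation : ∀ i → κ * z i + (L i - x i) ≈ 0#
    relation i = begin
      κ * z i + (L i - x i)   ≈⟨ solve 3 (λ a b x → a :+ (b :+ :- x) := (a :+ b) :+ :- x) refl (κ * z i) (L i) (x i) ⟩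
      (κ * z i + L i) - x i   ≈⟨ +-congʳ (x≈ i) ⟨
      x i - x i               ≈⟨ -‿inverseʳ (x i) ⟩
      0#                      ∎

  independent-proportional : ∀ {t n} {u : Fin (suc t) → Vec n} → Independent u →
    ∀ {i j μ} → (∀ k → u i k ≈ μ * u j k) → i ≡ j × μ ≈ 1#
  independent-proportional {u = u} u-ind {i} {j} {μ} uᵢ≈μuⱼ = conclude (i Fin.≟ j)
    where
    cs : Fin _ → Carrier
    cs k = unit i k + (- μ) * unit j k
    csᵢ≈0 : cs i ≈ 0#
    csᵢ≈0 = u-ind cs (λ k → begin
      lincomb cs u k                                      ≈⟨ lincomb-+ (unit i) (λ k → (- μ) * unit j k) u k ⟩
      lincomb (unit i) u k + lincomb (λ k → (- μ) * unit j k) u k ≈⟨ +-cong (lincomb-unit u i k) (trans (lincomb-* (- μ) (unit j) u k) (*-congˡ (lincomb-unit u j k))) ⟩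
      u i k + (- μ) * u j k                               ≈⟨ +-cong (uᵢ≈μuⱼ k) (sym (-‿distribˡ-* μ (u j k))) ⟩
      μ * u j k - μ * u j k                               ≈⟨ -‿inverseʳ _ ⟩
      0#                                                   ∎) i
    unitᵢ≈1 : unit i i ≈ 1#
    unitᵢ≈1 = reflexive (insertAt-lookup (λ _ → 0#) i 1#)
    conclude : Dec (i ≡ j) → i ≡ j × μ ≈ 1#
    conclude (yes ≡.refl) = ≡.refl , sym (x∙y⁻¹≈ε⇒x≈y 1# μ (begin
      1# - μ                    ≈⟨ +-cong (sym unitᵢ≈1) (trans (sym (*-identityʳ (- μ))) (*-congˡ (sym unitᵢ≈1))) ⟩
      cs i                      ≈⟨ csᵢ≈0 ⟩
      0#                        ∎))
    conclude (no i≢j) = contradiction (begin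
      1#                        ≈⟨ +-identityʳ 1# ⟨
      1# + 0#                   ≈⟨ +-cong (sym unitᵢ≈1) (sym (trans (*-congˡ (unit-≢ (i≢j ∘ ≡.sym))) (zeroʳ _))) ⟩
      cs i                      ≈⟨ csᵢ≈0 ⟩
      0#                        ∎) 1≉0

  independent-∘punchIn : ∀ {t n} {u : Fin (suc t) → Vec n} → Independent u → ∀ p → Independent (u ∘ punchIn p)
  independent-∘punchIn {u = u} u-ind p cs cs·u≈0 k = trans (reflexive (≡.sym (insertAt-punchIn cs p 0# k)))
    (u-ind (insertAt cs p 0#) (λ i → trans (lincomb-insertAt cs p 0# u i) (trans (+-cong (zeroˡ _) (cs·u≈0 i)) (+-identityˡ 0#))) (punchIn p k))

  independent⇒∉Span-punchIn : ∀ {t n} {u : Fin (suc t) → Vec n} → Independent u → ∀ p → ¬ u p ∈Span (u ∘ punchIn p)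
  independent⇒∉Span-punchIn {u = u} u-ind p (cs , uₚ≈) = -1≉0 (begin
    - 1#                          ≡⟨ insertAt-lookup cs p (- 1#) ⟨
    insertAt cs p (- 1#) p        ≈⟨ u-ind (insertAt cs p (- 1#)) relation p ⟩
    0#                            ∎)
    where
    relation : ∀ i → lincomb (insertAt cs p (- 1#)) u i ≈ 0#
    relation i = begin
      lincomb (insertAt cs p (- 1#)) u i          ≈⟨ lincomb-insertAt cs p (- 1#) u i ⟩
      (- 1#) * u p i + lincomb cs (u ∘ punchIn p) i ≈⟨ +-cong (-1*x≈-x (u p i)) (sym (uₚ≈ i)) ⟩
      - u p i + u p i                              ≈⟨ -‿inverseˡ (u p i) ⟩
      0#                                            ∎

  ∼-refl : ∀ {n} (x : Vec n) → x ∼ x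
  ∼-refl x = 1# , 1≉0 , λ i → sym (*-identityˡ (x i))

  ∼-sym : ∀ {n} {x y : Vec n} → x ∼ y → y ∼ x
  ∼-sym {x = x} {y} (μ , μ≉0 , x≈μy) = inv μ μ≉0 , inv-≉0 μ μ≉0 , λ i → begin
    y i                       ≈⟨ *-identityˡ (y i) ⟨
    1# * y i                  ≈⟨ *-congʳ (trans (*-comm _ _) (*-inverseʳ μ μ≉0)) ⟨
    (inv μ μ≉0 * μ) * y i     ≈⟨ *-assoc _ _ _ ⟩
    inv μ μ≉0 * (μ * y i)     ≈⟨ *-congˡ (x≈μy i) ⟨
    inv μ μ≉0 * x i           ∎

  ∼-trans : ∀ {n} {x y z : Vec n} → x ∼ y → y ∼ z → x ∼ z
  ∼-trans {z = z} (μ , μ≉0 , x≈μy) (ν , ν≉0 , y≈νz) =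
    μ * ν , *-≉0 μ≉0 ν≉0 , λ i → trans (x≈μy i) (trans (*-congˡ (y≈νz i)) (sym (*-assoc μ ν (z i))))

  ∼-∈Span : ∀ {t n} {x y : Vec n} (u : Fin t → Vec n) → x ∼ y → y ∈Span u → x ∈Span u
  ∼-∈Span u (μ , _ , x≈μy) y∈u = ∈Span-resp x≈μy (∈Span-* μ u y∈u)

  lookup-∈pt : ∀ {n} (L : List (Vec n)) i → lookup L i ∈pt L
  lookup-∈pt (x List.∷ L) zero    = here (∼-refl x)
  lookup-∈pt (x List.∷ L) (suc i) = there (lookup-∈pt L i)

  sameSpan-listed : ∀ {s t n} (L : List (Vec n)) (u : Fin t → Vec n) (y : Fin s → Vec n) →
    (∀ j → y j ∈pt L) → SameSpan y u → ∃ λ (f : Fin s → Fin (length L)) → SameSpan (λ j → lookup L (f j)) u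
  sameSpan-listed {s} L u y y∈L (y⊆u , u⊆y) = f , (λ j → ∼-∈Span u (∼-sym (yⱼ∼ j)) (y⊆u j)) ,
    λ k → ∈Span-trans (u⊆y k) (λ j → ∼-∈Span (λ j → lookup L (f j)) (yⱼ∼ j) (∈Span-member (λ j → lookup L (f j)) j))
    where
    f : Fin s → Fin (length L)
    f j = index (y∈L j)
    yⱼ∼ : ∀ j → y j ∼ lookup L (f j)
    yⱼ∼ j = Anyₚ.lookup-index (y∈L j)

  dot : ∀ {n} → Vec n → Vec n → Carrier
  dot {n} a x = sumF n (λ i → a i * x i)

  dot-cong : ∀ {n} (a : Vec n) {x y : Vec n} → (∀ i → x i ≈ y i) → dot a x ≈ dot a y
  dot-cong {n} a x≈y = sumF-cong n (λ i → *-congˡ (x≈y i))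

  dot-+ᵥ : ∀ {n} (a x y : Vec n) → dot a (x +ᵥ y) ≈ dot a x + dot a y
  dot-+ᵥ {n} a x y = trans (sumF-cong n (λ i → distribˡ (a i) (x i) (y i))) (sumF-+ n _ _)

  dot-*ᵥ : ∀ {n} (a : Vec n) μ (x : Vec n) → dot a (μ *ᵥ x) ≈ μ * dot a x
  dot-*ᵥ {n} a μ x = trans (sumF-cong n (λ i → x∙yz≈y∙xz (a i) μ (x i))) (sumF-*ˡ n μ _)
    where open import Algebra.Properties.CommutativeSemigroup *-commutativeSemigroup using (x∙yz≈y∙xz)

  dot-lincomb : ∀ {t n} (a : Vec n) (cs : Fin t → Carrier) (u : Fin t → Vec n) →
    dot a (lincomb cs u) ≈ sumF t (λ k → cs k * dot a (u k))
  dot-lincomb {t} {n} a cs u = begin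
    sumF n (λ i → a i * sumF t (λ k → cs k * u k i))     ≈⟨ sumF-cong n (λ i → sym (sumF-*ˡ t (a i) _)) ⟩
    sumF n (λ i → sumF t (λ k → a i * (cs k * u k i)))   ≈⟨ sumF-comm n t _ ⟩
    sumF t (λ k → sumF n (λ i → a i * (cs k * u k i)))   ≈⟨ sumF-cong t (λ k → dot-*ᵥ a (cs k) (u k)) ⟩
    sumF t (λ k → cs k * dot a (u k))                     ∎

  dot-zero : ∀ {n} (a x : Vec n) → (∀ i → x i ≈ 0#) → dot a x ≈ 0#
  dot-zero {n} a x x≈0 = sumF-zero n (λ i → trans (*-congˡ (x≈0 i)) (zeroʳ _))

  ∉Hyp⇒IsPoint : ∀ {n} (a x : Vec n) → ¬ InHyp a x → IsPoint x
  ∉Hyp⇒IsPoint a x x∉H x≈0 = x∉H (dot-zero a x x≈0)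

  ∼-InHyp : ∀ {n} (a : Vec n) {x y : Vec n} → x ∼ y → InHyp a y → InHyp a x
  ∼-InHyp a {y = y} (μ , _ , x≈μy) y∈H = trans (dot-cong a x≈μy) (trans (dot-*ᵥ a μ y) (trans (*-congˡ y∈H) (zeroʳ μ)))

  InHyp-∼ : ∀ {n} (a : Vec n) {x y : Vec n} → x ∼ y → InHyp a x → InHyp a y
  InHyp-∼ a {y = y} (μ , μ≉0 , x≈μy) x∈H = x*y≈0⇒y≈0 μ≉0 (trans (sym (trans (dot-cong a x≈μy) (dot-*ᵥ a μ y))) x∈H)

  ∉Hyp-∼ : ∀ {n} (a : Vec n) {x y : Vec n} → x ∼ y → ¬ InHyp a y → ¬ InHyp a x
  ∉Hyp-∼ a x∼y y∉H x∈H = y∉H (InHyp-∼ a x∼y x∈H)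

  InHyp-≁-∉Hyp : ∀ {n} (a : Vec n) {x y : Vec n} → InHyp a x → ¬ InHyp a y → ¬ x ∼ y
  InHyp-≁-∉Hyp a x∈H y∉H x∼y = ∉Hyp-∼ a x∼y y∉H x∈H

  ∉Hyp-≁-InHyp : ∀ {n} (a : Vec n) {x y : Vec n} → ¬ InHyp a x → InHyp a y → ¬ x ∼ y
  ∉Hyp-≁-InHyp a x∉H y∈H x∼y = x∉H (∼-InHyp a x∼y y∈H)

  Dependent : ∀ {t n} → (Fin t → Vec n) → Set (c ⊔ ℓ)
  Dependent u = ∃ λ cs → (∃ λ j → ¬ cs j ≈ 0#) × (∀ i → lincomb cs u i ≈ 0#)

  independent⇒¬dependent : ∀ {t n} {u : Fin t → Vec n} → Independent u → ¬ Dependent u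
  independent⇒¬dependent u-ind (cs , (j , csⱼ≉0) , cs·u≈0) = csⱼ≉0 (u-ind cs cs·u≈0 j)

  dependent-∘suc : ∀ {t n} (u : Fin (suc t) → Vec n) → Dependent (u ∘ suc) → Dependent u
  dependent-∘suc u (cs , (j , csⱼ≉0) , cs·u≈0) =
    (0# ∷ cs) , (suc j , csⱼ≉0) , λ i → trans (+-congʳ (zeroˡ _)) (trans (+-identityˡ _) (cs·u≈0 i))

  dependent-∷⇒∈Span : ∀ {t n} {x : Vec n} {w : Fin t → Vec n} → Independent w → Dependent (x ∷ w) → x ∈Span w
  dependent-∷⇒∈Span {x = x} {w} w-ind (cs , (j , csⱼ≉0) , cs·xw≈0) =
    (λ k → (- inv c₀ c₀≉0) * cs (suc k)) ,
    λ i → trans (solve-linear c₀≉0 (cs·xw≈0 i)) (sym (lincomb-* _ (cs ∘ suc) w i))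
    where
    c₀ : Carrier
    c₀ = cs zero
    c₀≉0 : ¬ c₀ ≈ 0#
    c₀≉0 c₀≈0 = csⱼ≉0 (cs≈0 j)
      where
      cs·w≈0 : ∀ i → lincomb (cs ∘ suc) w i ≈ 0#
      cs·w≈0 i = trans (sym (trans (+-congʳ (x≈0⇒x*y≈0 (x i) c₀≈0)) (+-identityˡ _))) (cs·xw≈0 i)
      cs≈0 : ∀ j → cs j ≈ 0#
      cs≈0 zero    = c₀≈0
      cs≈0 (suc k) = w-ind (cs ∘ suc) cs·w≈0 k

  dot-lincomb-∷ : ∀ {t n} (a o : Vec n) {w : Fin t → Vec n} → (∀ k → InHyp a (w k)) → ∀ cs →
    dot a (lincomb cs (o ∷ w)) ≈ cs zero * dot a o
  dot-lincomb-∷ {t} a o {w} w∈H cs = begin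
    dot a (lincomb cs (o ∷ w))                                 ≈⟨ dot-lincomb a cs (o ∷ w) ⟩
    cs zero * dot a o + sumF t (λ k → cs (suc k) * dot a (w k)) ≈⟨ +-congˡ (sumF-zero t (λ k → trans (*-congˡ (w∈H k)) (zeroʳ _))) ⟩
    cs zero * dot a o + 0#                                     ≈⟨ +-identityʳ _ ⟩
    cs zero * dot a o                                          ∎

  independent-∷ : ∀ {t n} (a o : Vec n) {w : Fin t → Vec n} → ¬ InHyp a o → (∀ k → InHyp a (w k)) →
    Independent w → Independent (o ∷ w)
  independent-∷ a o {w} o∉H w∈H w-ind cs cs·ow≈0 = cs≈0
    where
    c₀≈0 : cs zero ≈ 0#
    c₀≈0 = x*y≈0⇒x≈0 o∉H (trans (sym (dot-lincomb-∷ a o w∈H cs)) (dot-zero a _ cs·ow≈0))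
    cs≈0 : ∀ j → cs j ≈ 0#
    cs≈0 zero    = c₀≈0
    cs≈0 (suc k) = w-ind (cs ∘ suc)
      (λ i → trans (sym (trans (+-congʳ (x≈0⇒x*y≈0 (o i) c₀≈0)) (+-identityˡ _))) (cs·ow≈0 i)) k

  ∈Span-∷-InHyp : ∀ {t n} (a o : Vec n) {w : Fin t → Vec n} {x : Vec n} → ¬ InHyp a o →
    (∀ k → InHyp a (w k)) → InHyp a x → x ∈Span (o ∷ w) → x ∈Span w
  ∈Span-∷-InHyp a o {w} {x} o∉H w∈H x∈H (cs , x≈) = cs ∘ suc , λ i →
    trans (x≈ i) (trans (+-congʳ (x≈0⇒x*y≈0 (o i) c₀≈0)) (+-identityˡ _))
    where
    c₀≈0 : cs zero ≈ 0#
    c₀≈0 = x*y≈0⇒x≈0 o∉H (trans (sym (dot-lincomb-∷ a o w∈H cs)) (trans (sym (dot-cong a x≈)) x∈H))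

  dependent-from-tails : ∀ {t n} (z : Fin t → Vec (suc n)) → (∀ k → z k zero ≈ 0#) →
    Dependent (λ k i → z k (suc i)) → Dependent z
  dependent-from-tails {t} z z₀≈0 (cs , nontrivial , cs·z≈0) = cs , nontrivial , λ
    { zero    → sumF-zero t (λ k → trans (*-congˡ (z₀≈0 k)) (zeroʳ _))
    ; (suc i) → cs·z≈0 i
    }

  module Projection {n} (a o : Vec n) (o∉H : ¬ InHyp a o) where

    coeff : Vec n → Carrier
    coeff x = dot a x * inv (dot a o) o∉H

    project : Vec n → Vec n
    project x = x +ᵥ (- coeff x) *ᵥ o

    project-InHyp : ∀ x → InHyp a (project x)
    project-InHyp x = begin
      dot a (project x)                            ≈⟨ dot-+ᵥ a x _ ⟩
      dot a x + dot a ((- coeff x) *ᵥ o)          ≈⟨ +-congˡ (dot-*ᵥ a _ o) ⟩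
      dot a x + (- (dot a x * o⁻¹)) * dot a o      ≈⟨ solve 3 (λ d i e → d :+ (:- (d :* i)) :* e := d :+ :- (d :* (e :* i))) refl (dot a x) o⁻¹ (dot a o) ⟩
      dot a x - dot a x * (dot a o * o⁻¹)         ≈⟨ +-congˡ (-‿cong (trans (*-congˡ (*-inverseʳ _ o∉H)) (*-identityʳ _))) ⟩
      dot a x - dot a x                            ≈⟨ -‿inverseʳ _ ⟩
      0#                                            ∎
      where
      o⁻¹ : Carrier
      o⁻¹ = inv (dot a o) o∉H

    project-∈Span : ∀ {t} {g : Fin t → Vec n} {x} → x ∈Span g → o ∈Span g → project x ∈Span g
    project-∈Span {g = g} x∈g o∈g = ∈Span-+ g x∈g (∈Span-* _ g o∈g)

    ∈Span-∷-project : ∀ {t} {b : Fin t → Vec n} {x} → project x ∈Span b → x ∈Span (o ∷ b)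
    ∈Span-∷-project {x = x} (cs , px≈) = (coeff x ∷ cs) , λ i → trans (x≈ i) (+-congˡ (px≈ i))
      where
      x≈ : ∀ i → x i ≈ coeff x * o i + project x i
      x≈ i = solve 3 (λ x c o → x := c :* o :+ (x :+ (:- c) :* o)) refl (x i) (coeff x) (o i)

    lincomb-project : ∀ {t} (cs : Fin t → Carrier) (y : Fin t → Vec n) i →
      lincomb cs (project ∘ y) i ≈ (- sumF t (λ k → cs k * coeff (y k))) * o i + lincomb cs y i
    lincomb-project {zero}  cs y i = solve 1 (λ o → con (ℤ.+ 0) := (:- con (ℤ.+ 0)) :* o :+ con (ℤ.+ 0)) refl (o i)
    lincomb-project {suc t} cs y i = trans (+-congˡ (lincomb-project (cs ∘ suc) (y ∘ suc) i))
      (solve 6 (λ c x r o R S → c :* (x :+ (:- r) :* o) :+ ((:- R) :* o :+ S) := (:- (c :* r :+ R)) :* o :+ (c :* x :+ S)) refl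
        (cs zero) (y zero i) (coeff (y zero)) (o i) (sumF t (λ k → cs (suc k) * coeff (y (suc k)))) (lincomb (cs ∘ suc) (y ∘ suc) i))

  module _ {t n} (a : Vec n) (u : Fin (suc t) → Vec n) (p : Fin (suc t)) (up∉H : ¬ InHyp a (u p)) where
    open Projection a (u p) up∉H

    private
      pivot : (Fin t → Carrier) → Carrier
      pivot cs = - sumF t (λ k → cs k * coeff (u (punchIn p k)))

      lincomb-project-punchIn : ∀ cs i → lincomb cs (project ∘ u ∘ punchIn p) i ≈ lincomb (insertAt cs p (pivot cs)) u i
      lincomb-project-punchIn cs i = trans (lincomb-project cs (u ∘ punchIn p) i) (sym (lincomb-insertAt cs p _ u i))

    independent-project : Independent u → Independent (project ∘ u ∘ punchIn p)
    independent-project u-ind cs cs·≈0 k = trans (reflexive (≡.sym (insertAt-punchIn cs p (pivot cs) k)))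
      (u-ind (insertAt cs p (pivot cs)) (λ i → trans (sym (lincomb-project-punchIn cs i)) (cs·≈0 i)) (punchIn p k))

    dependent-project : Dependent (project ∘ u ∘ punchIn p) → Dependent u
    dependent-project (cs , (j , csⱼ≉0) , cs·≈0) =
      insertAt cs p (pivot cs) ,
      (punchIn p j , ≉0-resp-≈ (reflexive (≡.sym (insertAt-punchIn cs p (pivot cs) j))) csⱼ≉0) ,
      λ i → trans (sym (lincomb-project-punchIn cs i)) (cs·≈0 i)

  e₀ : ∀ {n} → Vec (suc n)
  e₀ = 1# ∷ λ _ → 0#

  dot-e₀ : ∀ {n} (x : Vec (suc n)) → dot e₀ x ≈ x zero
  dot-e₀ {n} x = trans (+-cong (*-identityˡ _) (sumF-zero n (λ i → zeroˡ _))) (+-identityʳ _)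

  module Elimination (_≟0 : ∀ x → Dec (x ≈ 0#)) where

    -- Gaussian elimination of the first coordinate.
    dependent-overdetermined : ∀ n (y : Fin (suc n) → Vec n) → Dependent y
    dependent-overdetermined zero    y = (λ _ → 1#) , (zero , 1≉0) , λ ()
    dependent-overdetermined (suc n) y with all? (λ k → y k zero ≟0)
    ... | yes y₀≈0 = dependent-∘suc y (dependent-from-tails (y ∘ suc) (y₀≈0 ∘ suc)
                       (dependent-overdetermined n (λ k i → y (suc k) (suc i))))
    ... | no ¬y₀≈0 with ¬∀⟶∃¬ _ _ (λ k → y k zero ≟0) ¬y₀≈0
    ...   | p , yₚ₀≉0 = dependent-project e₀ y p yₚ∉H
            (dependent-from-tails z (λ k → trans (sym (dot-e₀ (z k))) (project-InHyp (y (punchIn p k))))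
              (dependent-overdetermined n (λ k i → z k (suc i))))
      where
      yₚ∉H : ¬ InHyp e₀ (y p)
      yₚ∉H yₚ∈H = yₚ₀≉0 (trans (sym (dot-e₀ (y p))) yₚ∈H)
      open Projection e₀ (y p) yₚ∉H
      z : Fin (suc n) → Vec (suc n)
      z = project ∘ y ∘ punchIn p

    dependent-in-span : ∀ {m n} (g : Fin m → Vec n) (y : Fin (suc m) → Vec n) → (∀ k → y k ∈Span g) → Dependent y
    dependent-in-span {m} g y y⊆g with dependent-overdetermined m (proj₁ ∘ y⊆g)
    ... | cs , nontrivial , cs·ds≈0 = cs , nontrivial , λ i →
      trans (lincomb-congʳ cs (proj₂ ∘ y⊆g) i) (trans (lincomb-lincomb cs (proj₁ ∘ y⊆g) g i) (lincomb-zero g cs·ds≈0 i))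

    independent-⊈-smaller : ∀ {m n} {y : Fin (suc m) → Vec n} (g : Fin m → Vec n) → Independent y → ¬ (∀ k → y k ∈Span g)
    independent-⊈-smaller {y = y} g y-ind y⊆g = independent⇒¬dependent {u = y} y-ind (dependent-in-span g y y⊆g)

    independent-spans : ∀ {t n} (g w : Fin t → Vec n) → Independent w → (∀ k → w k ∈Span g) →
      ∀ {x} → x ∈Span g → x ∈Span w
    independent-spans g w w-ind w⊆g x∈g =
      dependent-∷⇒∈Span w-ind (dependent-in-span g (_ ∷ w) λ { zero → x∈g ; (suc k) → w⊆g k })

    independent-spans-all : ∀ {n} (w : Fin n → Vec n) → Independent w → ∀ x → x ∈Span w
    independent-spans-all w w-ind x = dependent-∷⇒∈Span w-ind (dependent-overdetermined _ (x ∷ w))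

    independent-[_] : ∀ {n} {x : Vec n} → IsPoint x → Independent (x ∷ [])
    independent-[_] {x = x} x≢0 cs cs·x≈0 zero with cs zero ≟0
    ... | yes c≈0 = c≈0
    ... | no  c≉0 = contradiction (λ i → x*y≈0⇒y≈0 c≉0 (trans (sym (+-identityʳ _)) (cs·x≈0 i))) x≢0

    plane-meets-span : ∀ {t} (g : Fin (suc t) → Vec (suc (suc t))) → Independent g → ∀ x y →
      ∃₂ λ c d → (¬ c ≈ 0# ⊎ ¬ d ≈ 0#) × (c *ᵥ x +ᵥ d *ᵥ y) ∈Span g
    plane-meets-span {t} g g-ind x y with dependent-overdetermined (suc (suc t)) (x ∷ y ∷ g)
    ... | cs , (j , csⱼ≉0) , cs·≈0 = c₀ , c₁ , nontrivial (c₀ ≟0) (c₁ ≟0) , (λ k → (- 1#) * cs (suc (suc k))) , z∈g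
      where
      c₀ c₁ : Carrier
      c₀ = cs zero
      c₁ = cs (suc zero)
      L : Vec (suc (suc t))
      L = lincomb (λ k → cs (suc (suc k))) g
      nontrivial : Dec (c₀ ≈ 0#) → Dec (c₁ ≈ 0#) → ¬ c₀ ≈ 0# ⊎ ¬ c₁ ≈ 0#
      nontrivial (no c₀≉0) _           = inj₁ c₀≉0
      nontrivial (yes _)   (no c₁≉0)   = inj₂ c₁≉0
      nontrivial (yes c₀≈0) (yes c₁≈0) = contradiction (cs≈0 j) csⱼ≉0
        where
        L≈0 : ∀ i → L i ≈ 0#
        L≈0 i = trans (sym (trans (+-cong (x≈0⇒x*y≈0 (x i) c₀≈0) (trans (+-congʳ (x≈0⇒x*y≈0 (y i) c₁≈0)) (+-identityˡ _))) (+-identityˡ _))) (cs·≈0 i)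
        cs≈0 : ∀ j → cs j ≈ 0#
        cs≈0 zero          = c₀≈0
        cs≈0 (suc zero)    = c₁≈0
        cs≈0 (suc (suc k)) = g-ind (λ k → cs (suc (suc k))) L≈0 k
      z∈g : ∀ i → c₀ * x i + c₁ * y i ≈ lincomb (λ k → (- 1#) * cs (suc (suc k))) g i
      z∈g i = begin
        c₀ * x i + c₁ * y i                        ≈⟨ solve 3 (λ A B L → A :+ B := (A :+ (B :+ L)) :+ :- L) refl (c₀ * x i) (c₁ * y i) (L i) ⟩
        (c₀ * x i + (c₁ * y i + L i)) - L i        ≈⟨ +-congʳ (cs·≈0 i) ⟩
        0# - L i                                   ≈⟨ +-identityˡ _ ⟩
        - L i                                      ≈⟨ -1*x≈-x (L i) ⟨
        (- 1#) * L i                               ≈⟨ lincomb-* (- 1#) (λ k → cs (suc (suc k))) g i ⟨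
        lincomb (λ k → (- 1#) * cs (suc (suc k))) g i ∎

module FiniteField {c ℓ} (F : Field c ℓ) where
  open Field F hiding (zero)

  record NonzeroEnumeration (m : ℕ) : Set (c ⊔ ℓ) where
    field
      element            : Fin m → Carrier
      element≉0          : ∀ j → ¬ element j ≈ 0#
      element-injective  : ∀ {j j′} → element j ≈ element j′ → j ≡ j′
      element-surjective : ∀ x → ¬ x ≈ 0# → ∃ λ j → x ≈ element j

  lookup-injective : ∀ {xs : List Carrier} → AllPairs (λ x y → ¬ x ≈ y) xs →
    ∀ i j → lookup xs i ≈ lookup xs j → i ≡ j
  lookup-injective (_ AllPairs.∷ _)        zero    zero    _ = ≡.refl
  lookup-injective (x≉xs AllPairs.∷ _)     zero    (suc j) x≈ = contradiction x≈ (All.lookup x≉xs (∈-lookup j))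
  lookup-injective (x≉xs AllPairs.∷ _)     (suc i) zero    ≈x = contradiction (sym ≈x) (All.lookup x≉xs (∈-lookup i))
  lookup-injective (_ AllPairs.∷ distinct) (suc i) (suc j) xᵢ≈xⱼ = ≡.cong suc (lookup-injective distinct i j xᵢ≈xⱼ)

  module Enumerated {xs : List Carrier} (distinct : AllPairs (λ x y → ¬ x ≈ y) xs)
                    (covers : ∀ x → Any (x ≈_) xs) where

    position : Carrier → Fin (length xs)
    position x = index (covers x)

    ≈lookup-position : ∀ x → x ≈ lookup xs (position x)
    ≈lookup-position x = Anyₚ.lookup-index (covers x)

    position-≡⇒≈ : ∀ {x y} → position x ≡ position y → x ≈ y
    position-≡⇒≈ {x} {y} eq =
      trans (≈lookup-position x) (trans (reflexive (≡.cong (lookup xs) eq)) (sym (≈lookup-position y)))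

    ≈⇒position-≡ : ∀ {x y} → x ≈ y → position x ≡ position y
    ≈⇒position-≡ {x} {y} x≈y =
      lookup-injective distinct _ _ (trans (sym (≈lookup-position x)) (trans x≈y (≈lookup-position y)))

    _≟0 : ∀ x → Dec (x ≈ 0#)
    x ≟0 = map′ position-≡⇒≈ ≈⇒position-≡ (position x Fin.≟ position 0#)

  nonzeroEnumeration : ∀ xs → AllPairs (λ x y → ¬ x ≈ y) xs → (∀ x → Any (x ≈_) xs) →
    NonzeroEnumeration (length xs ℕ.∸ 1)
  nonzeroEnumeration List.[]       _        covers = contradiction (covers 0#) λ ()
  nonzeroEnumeration (x List.∷ xs) distinct covers = record
    { element            = element
    ; element≉0          = λ j eⱼ≈0 → punchInᵢ≢i z j (lookup-injective distinct _ _ (trans eⱼ≈0 (≈lookup-position 0#)))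
    ; element-injective  = λ eⱼ≈eⱼ′ → punchIn-injective z _ _ (lookup-injective distinct _ _ eⱼ≈eⱼ′)
    ; element-surjective = surjective
    }
    where
    open Enumerated distinct covers
    z : Fin (suc (length xs))
    z = position 0#
    element : Fin (length xs) → Carrier
    element j = lookup (x List.∷ xs) (punchIn z j)
    surjective : ∀ y → ¬ y ≈ 0# → ∃ λ j → y ≈ element j
    surjective y y≉0 = punchOut z≢y , trans (≈lookup-position y)
      (reflexive (≡.cong (lookup (x List.∷ xs)) (≡.sym (punchIn-punchOut z≢y))))
      where
      z≢y : z ≢ position y
      z≢y eq = y≉0 (position-≡⇒≈ (≡.sym eq))

  hasOrder⇒≟0 : ∀ {q} → HasOrder F q → ∀ x → Dec (x ≈ 0#)
  hasOrder⇒≟0 (_ , _ , distinct , covers) = Enumerated._≟0 distinct covers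

  hasOrder⇒nonzeroEnumeration : ∀ {q} → HasOrder F q → NonzeroEnumeration (q ℕ.∸ 1)
  hasOrder⇒nonzeroEnumeration (els , ≡.refl , distinct , covers) = nonzeroEnumeration els distinct covers

∀⊎⟶⊎∀ : ∀ {a b n} {A : Set a} {B : Fin n → Set b} → (∀ i → A ⊎ B i) → A ⊎ (∀ i → B i)
∀⊎⟶⊎∀ {n = zero}  choice = inj₂ λ ()
∀⊎⟶⊎∀ {n = suc n} choice with choice zero | ∀⊎⟶⊎∀ (choice ∘ suc)
... | inj₁ a  | _        = inj₁ a
... | inj₂ _  | inj₁ a   = inj₁ a
... | inj₂ b₀ | inj₂ bₛ  = inj₂ λ { zero → b₀ ; (suc i) → bₛ i }

module Construction {c ℓ} (F : Field c ℓ) (_≟0 : ∀ x → Dec (Field._≈_ F x (Field.0# F)))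
  {m} (nonzero : FiniteField.NonzeroEnumeration F m) (v′ : ℕ) where

  open Field F hiding (zero)
  open Geometry F
  open LinearAlgebra F
  open Elimination _≟0
  open FiniteField.NonzeroEnumeration nonzero
  open IntegerRingSolver commutativeRing using (solve; _:=_; _:+_; _:*_; :-_)
  open import Relation.Binary.Reasoning.Setoid setoid

  v : ℕ
  v = suc v′

  N : ℕ
  N = suc (suc v)

  module Configuration (a : Vec N) (B : List (Vec N)) (B⊆H : All (InHyp a) B) (B-blocking : StrongBlockingIn (InHyp a) v B)
    (P : Fin (suc v) → Vec N) (P-point : ∀ i → IsPoint (P i)) (P⊆H : ∀ i → InHyp a (P i)) (P-ind : Independent P)
    (l : Fin (suc v) → Fin 2 → Vec N) (Q : Vec N) (Q-point : IsPoint Q) (Q∈l : ∀ i → Q ∈Span l i)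
    (l∩H : ∀ i x → IsPoint x → ((x ∈Span l i × InHyp a x) ⇔ x ∼ P i)) where

    -- Otherwise Q, lying on every line lᵢ, would be P₀ = P₁.
    Q∉H : ¬ InHyp a Q
    Q∉H Q∈H = contradiction (proj₁ (independent-proportional {u = P} P-ind (proj₂ (proj₂ P₀∼P₁)))) λ ()
      where
      Q∼P : ∀ i → Q ∼ P i
      Q∼P i = Equivalence.to (l∩H i Q Q-point) (Q∈l i , Q∈H)
      P₀∼P₁ : P zero ∼ P (suc zero)
      P₀∼P₁ = ∼-trans (∼-sym (Q∼P zero)) (Q∼P (suc zero))

    P∈l : ∀ i → P i ∈Span l i
    P∈l i = proj₁ (Equivalence.from (l∩H i (P i) (P-point i)) (∼-refl (P i)))

    R : Fin (suc v) → Carrier → Vec N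
    R i t = P i +ᵥ t *ᵥ Q

    dot-R : ∀ i t → dot a (R i t) ≈ t * dot a Q
    dot-R i t = trans (dot-+ᵥ a (P i) (t *ᵥ Q)) (trans (+-cong (P⊆H i) (dot-*ᵥ a t Q)) (+-identityˡ _))

    R∉H : ∀ i {t} → ¬ t ≈ 0# → ¬ InHyp a (R i t)
    R∉H i t≉0 R∈H = *-≉0 t≉0 Q∉H (trans (sym (dot-R i _)) R∈H)

    R∈l : ∀ i t → R i t ∈Span l i
    R∈l i t = ∈Span-+ (l i) (P∈l i) (∈Span-* t (l i) (Q∈l i))

    ∼-R-components : ∀ {y s μ i t} → InHyp a y → (∀ k → y k + s * Q k ≈ μ * R i t k) → s ≈ μ * t × (∀ k → y k ≈ μ * P i k)
    ∼-R-components {y} {s} {μ} {i} {t} y∈H y+sQ≈μR = s≈μt , y≈μP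
      where
      s≈μt : s ≈ μ * t
      s≈μt = *-cancelʳ-≉0 Q∉H (begin
        s * dot a Q                ≈⟨ +-identityˡ _ ⟨
        0# + s * dot a Q           ≈⟨ +-cong y∈H (dot-*ᵥ a s Q) ⟨
        dot a y + dot a (s *ᵥ Q)   ≈⟨ dot-+ᵥ a y (s *ᵥ Q) ⟨
        dot a (y +ᵥ s *ᵥ Q)        ≈⟨ dot-cong a y+sQ≈μR ⟩
        dot a (μ *ᵥ R i t)         ≈⟨ trans (dot-*ᵥ a μ (R i t)) (*-congˡ (dot-R i t)) ⟩
        μ * (t * dot a Q)          ≈⟨ *-assoc μ t _ ⟨
        (μ * t) * dot a Q          ∎)
      y≈μP : ∀ k → y k ≈ μ * P i k
      y≈μP k = begin
        y k                                     ≈⟨ solve 3 (λ y s q → y := (y :+ s :* q) :+ :- (s :* q)) refl (y k) s (Q k) ⟩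
        (y k + s * Q k) - s * Q k               ≈⟨ +-cong (y+sQ≈μR k) (-‿cong (*-congʳ s≈μt)) ⟩
        μ * (P i k + t * Q k) - (μ * t) * Q k   ≈⟨ solve 4 (λ μ p t q → μ :* (p :+ t :* q) :+ :- ((μ :* t) :* q) := μ :* p) refl μ (P i k) t (Q k) ⟩
        μ * P i k                               ∎

    Q≁R : ∀ i t → ¬ Q ∼ R i t
    Q≁R i t (μ , μ≉0 , Q≈μR) = P-point i λ k → x*y≈0⇒y≈0 μ≉0 (sym (proj₂ (∼-R-components {y = λ _ → 0#} {s = 1#}
      (dot-zero a _ (λ _ → refl)) (λ k → trans (+-identityˡ _) (trans (*-identityˡ (Q k)) (Q≈μR k)))) k))

    R-injective : ∀ {i t i′ t′} → R i t ∼ R i′ t′ → i ≡ i′ × t ≈ t′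
    R-injective {i} {t} {i′} {t′} (μ , _ , R≈μR′) = proj₁ i≡i′×μ≈1 , trans t≈μt′ (trans (*-congʳ (proj₂ i≡i′×μ≈1)) (*-identityˡ t′))
      where
      t≈μt′ : t ≈ μ * t′
      t≈μt′ = proj₁ (∼-R-components {y = P i} {s = t} {μ} {i′} {t′} (P⊆H i) R≈μR′)
      i≡i′×μ≈1 : i ≡ i′ × μ ≈ 1#
      i≡i′×μ≈1 = independent-proportional {u = P} P-ind (proj₂ (∼-R-components {y = P i} {s = t} {μ} {i′} {t′} (P⊆H i) R≈μR′))

    newPoint : Fin (suc v ℕ.* m) → Vec N
    newPoint k = R (proj₁ (remQuot {suc v} m k)) (element (proj₂ (remQuot {suc v} m k)))

    newPoint-combine : ∀ i j → newPoint (combine i j) ≡ R i (element j)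
    newPoint-combine i j = ≡.cong (λ (i , j) → R i (element j)) (remQuot-combine i j)

    newPoint∉H : ∀ k → ¬ InHyp a (newPoint k)
    newPoint∉H k = R∉H _ (element≉0 _)

    newPoint-injective : ∀ {k k′} → newPoint k ∼ newPoint k′ → k ≡ k′
    newPoint-injective {k} {k′} newPoint∼ = ≡.trans (≡.sym (combine-remQuot {suc v} m k))
      (≡.trans (≡.cong₂ combine (proj₁ (R-injective newPoint∼)) (element-injective (proj₂ (R-injective newPoint∼))))
               (combine-remQuot {suc v} m k′))

    B⋆ : List (Vec N)
    B⋆ = B ++ Q List.∷ tabulate newPoint

    B⋆-valid : ValidPointSet B → ValidPointSet B⋆
    B⋆-valid (B-points , B-distinct) =
      Allₚ.++⁺ B-points (Q-point All.∷ Allₚ.tabulate⁺ (λ k → ∉Hyp⇒IsPoint a _ (newPoint∉H k))) ,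
      AllPairsₚ.++⁺ B-distinct
        (Allₚ.tabulate⁺ (λ k → Q≁R _ _) AllPairs.∷ AllPairsₚ.tabulate⁺ (λ k≢k′ → k≢k′ ∘ newPoint-injective))
        (All.map (λ x∈H → InHyp-≁-∉Hyp a x∈H Q∉H All.∷ Allₚ.tabulate⁺ (InHyp-≁-∉Hyp a x∈H ∘ newPoint∉H)) B⊆H)

    length-B⋆ : length B⋆ ≡ length B ℕ.+ 1 ℕ.+ suc v ℕ.* m
    length-B⋆ = ≡.trans (Listₚ.length-++ B)
      (≡.trans (≡.cong (λ n → length B ℕ.+ suc n) (Listₚ.length-tabulate newPoint)) (≡.sym (ℕₚ.+-assoc (length B) 1 _)))

    OnNewLine : Vec N → Set (c ⊔ ℓ)
    OnNewLine x = ∃ λ i → x ∈Span l i × ¬ x ∼ P i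

    ∈B⋆⇒ : ∀ x → x ∈pt B⋆ → x ∈pt B ⊎ OnNewLine x
    ∈B⋆⇒ x x∈B⋆ with Anyₚ.++⁻ B x∈B⋆
    ... | inj₁ x∈B = inj₁ x∈B
    ... | inj₂ (here x∼Q) = inj₂ (zero , ∼-∈Span (l zero) x∼Q (Q∈l zero) , ∉Hyp-≁-InHyp a (∉Hyp-∼ a x∼Q Q∉H) (P⊆H zero))
    ... | inj₂ (there x∈new) with Anyₚ.tabulate⁻ x∈new
    ...   | k , x∼R = inj₂ (i , ∼-∈Span (l i) x∼R (R∈l i _) , ∉Hyp-≁-InHyp a (∉Hyp-∼ a x∼R (newPoint∉H k)) (P⊆H i))
      where
      i : Fin (suc v)
      i = proj₁ (remQuot {suc v} m k)

    on-line⇒∈B⋆ : ∀ {x i} → IsPoint x → x ∈Span l i → ¬ x ∼ P i → x ∈pt B⋆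
    on-line⇒∈B⋆ {x} {i} x-point x∈l x≁P = classify (t ≟0) (s ≟0)
      where
      QP-ind : Independent (Q ∷ P i ∷ [])
      QP-ind = independent-∷ a Q {P i ∷ []} Q∉H (λ { zero → P⊆H i }) independent-[ P-point i ]
      QP⊆l : ∀ k → (Q ∷ P i ∷ []) k ∈Span l i
      QP⊆l zero       = Q∈l i
      QP⊆l (suc zero) = P∈l i
      x∈QP : x ∈Span (Q ∷ P i ∷ [])
      x∈QP = independent-spans (l i) (Q ∷ P i ∷ []) QP-ind QP⊆l x∈l
      t s : Carrier
      t = proj₁ x∈QP zero
      s = proj₁ x∈QP (suc zero)
      x≈tQ+sP : ∀ k → x k ≈ t * Q k + s * P i k
      x≈tQ+sP k = trans (proj₂ x∈QP k) (+-congˡ (+-identityʳ _))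
      classify : Dec (t ≈ 0#) → Dec (s ≈ 0#) → x ∈pt B⋆
      classify (yes t≈0) (yes s≈0) = contradiction (λ k → trans (x≈tQ+sP k)
        (trans (+-cong (x≈0⇒x*y≈0 _ t≈0) (x≈0⇒x*y≈0 _ s≈0)) (+-identityˡ 0#))) x-point
      classify (yes t≈0) (no s≉0)  = contradiction (s , s≉0 , λ k → trans (x≈tQ+sP k)
        (trans (+-congʳ (x≈0⇒x*y≈0 _ t≈0)) (+-identityˡ _))) x≁P
      classify (no t≉0)  (yes s≈0) = Anyₚ.++⁺ʳ B (here (t , t≉0 , λ k → trans (x≈tQ+sP k)
        (trans (+-congˡ (x≈0⇒x*y≈0 _ s≈0)) (+-identityʳ _))))
      classify (no t≉0)  (no s≉0)  = on-new-point (element-surjective (t * s⁻¹) (*-≉0 t≉0 (inv-≉0 s s≉0)))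
        where
        s⁻¹ : Carrier
        s⁻¹ = inv s s≉0
        on-new-point : (∃ λ j → t * s⁻¹ ≈ element j) → x ∈pt B⋆
        on-new-point (j , ts⁻¹≈eⱼ) =
          Anyₚ.++⁺ʳ B (there (Anyₚ.tabulate⁺ (combine i j) (≡.subst (x ∼_) (≡.sym (newPoint-combine i j)) x∼R)))
          where
          x∼R : x ∼ R i (element j)
          x∼R = s , s≉0 , λ k → begin
            x k                                ≈⟨ x≈tQ+sP k ⟩
            t * Q k + s * P i k                ≈⟨ +-congʳ (*-congʳ (trans (sym (*-identityˡ t)) (*-congʳ (sym (*-inverseʳ s s≉0))))) ⟩
            ((s * s⁻¹) * t) * Q k + s * P i k  ≈⟨ solve 5 (λ s i t q p → ((s :* i) :* t) :* q :+ s :* p := s :* (p :+ (t :* i) :* q)) refl s s⁻¹ t (Q k) (P i k) ⟩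
            s * (P i k + (t * s⁻¹) * Q k)      ≈⟨ *-congˡ (+-congˡ (*-congʳ ts⁻¹≈eⱼ)) ⟩
            s * R i (element j) k              ∎

    ⇒∈B⋆ : ∀ x → IsPoint x → x ∈pt B ⊎ OnNewLine x → x ∈pt B⋆
    ⇒∈B⋆ x _       (inj₁ x∈B)             = Anyₚ.++⁺ˡ x∈B
    ⇒∈B⋆ x x-point (inj₂ (i , x∈l , x≁P)) = on-line⇒∈B⋆ x-point x∈l x≁P

    SpannedFromB⋆ : (Fin (suc v) → Vec N) → Set (c ⊔ ℓ)
    SpannedFromB⋆ u = ∃ λ (y : Fin (suc v) → Vec N) → (∀ j → y j ∈pt B⋆) × SameSpan y u

    H⊆Span : ∀ {w : Fin (suc v) → Vec N} → Independent w → (∀ k → InHyp a (w k)) → ∀ {x} → InHyp a x → x ∈Span w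
    H⊆Span {w} w-ind w⊆H {x} x∈H = ∈Span-∷-InHyp a Q {w} Q∉H w⊆H x∈H
      (independent-spans-all (Q ∷ w) (independent-∷ a Q {w} Q∉H w⊆H w-ind) x)

    -- Two applications of the blocking property of B, to H ∩ ⟨P₁,…,P_v⟩ and to
    -- H ∩ ⟨P₀,P₂,…,P_v⟩, together give v + 1 points of B spanning H.
    B-spans-H : ∃ λ (y : Fin (suc v) → Vec N) → (∀ j → y j ∈pt B) × (∀ j → InHyp a (y j)) × (∀ i → P i ∈Span y)
    B-spans-H = choose (all? (λ m → β m zero ≟0))
      where
      blocking-without : ∀ p → ∃ λ (f : Fin v → Fin (length B)) → SameSpan (λ j → lookup B (f j)) (P ∘ punchIn p)
      blocking-without p = B-blocking (P ∘ punchIn p) (independent-∘punchIn {u = P} P-ind p) (P⊆H ∘ punchIn p)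
      P⁺ : Fin v → Vec N
      P⁺ k = P (suc k)
      P⁺⁺ : Fin v′ → Vec N
      P⁺⁺ k = P (suc (suc k))
      f g : Fin v → Fin (length B)
      f = proj₁ (blocking-without zero)
      g = proj₁ (blocking-without (suc zero))
      b d : Fin v → Vec N
      b = lookup B ∘ f
      d = lookup B ∘ g
      P∖₀⊆b : ∀ k → P (suc k) ∈Span b
      P∖₀⊆b = proj₂ (proj₂ (blocking-without zero))
      P∖₁⊆d : ∀ k → P (punchIn (suc zero) k) ∈Span d
      P∖₁⊆d = proj₂ (proj₂ (blocking-without (suc zero)))
      β : Fin v → Fin v → Carrier
      β m = proj₁ (proj₁ (proj₂ (blocking-without (suc zero))) m)
      d≈ : ∀ m i → d m i ≈ lincomb (β m) (P zero ∷ P⁺⁺) i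
      d≈ m = proj₂ (proj₁ (proj₂ (blocking-without (suc zero))) m)
      choose : Dec (∀ m → β m zero ≈ 0#) →
        ∃ λ (y : Fin (suc v) → Vec N) → (∀ j → y j ∈pt B) × (∀ j → InHyp a (y j)) × (∀ i → P i ∈Span y)
      choose (yes β₀≈0) = contradiction (∈Span-trans {y = d} {g = P⁺} (P∖₁⊆d zero) d⊆P∖₀) (independent⇒∉Span-punchIn {u = P} P-ind zero)
        where
        d⊆P∖₀ : ∀ m → d m ∈Span P⁺
        d⊆P∖₀ m = ∈Span-∷ (P (suc zero)) (P⁺⁺) (∈Span-∷-zero {z = P zero} {P⁺⁺} (β m) (d≈ m) (β₀≈0 m))
      choose (no ¬β₀≈0) with ¬∀⟶∃¬ _ _ (λ m → β m zero ≟0) ¬β₀≈0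
      ... | m , βₘ₀≉0 = (d m ∷ b) , y∈B , y⊆H , P⊆y
        where
        y∈B : ∀ j → (d m ∷ b) j ∈pt B
        y∈B zero    = lookup-∈pt B (g m)
        y∈B (suc k) = lookup-∈pt B (f k)
        y⊆H : ∀ j → InHyp a ((d m ∷ b) j)
        y⊆H zero    = All.lookup B⊆H (∈-lookup (g m))
        y⊆H (suc k) = All.lookup B⊆H (∈-lookup (f k))
        P⊆y : ∀ i → P i ∈Span (d m ∷ b)
        P⊆y zero    = ∈Span-trans {y = d m ∷ P⁺⁺} {g = d m ∷ b} (∈Span-exchange {z = P zero} {P⁺⁺} (β m) (d≈ m) βₘ₀≉0) λ
          { zero    → ∈Span-member (d m ∷ b) zero
          ; (suc k) → ∈Span-∷ (d m) b (P∖₀⊆b (suc k))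
          }
        P⊆y (suc k) = ∈Span-∷ (d m) b (P∖₀⊆b k)

    spanned-in-H : ∀ u → Independent u → (∀ k → InHyp a (u k)) → SpannedFromB⋆ u
    spanned-in-H u u-ind u⊆H with B-spans-H
    ... | y , y∈B , y⊆H , P⊆y =
      y , Anyₚ.++⁺ˡ ∘ y∈B , (λ j → H⊆Span {u} u-ind u⊆H (y⊆H j)) , λ k → ∈Span-trans {y = P} {g = y} (H⊆Span {P} P-ind P⊆H (u⊆H k)) P⊆y

    spanned-off-H : ∀ u → Independent u → ∀ p → ¬ InHyp a (u p) → SpannedFromB⋆ u
    spanned-off-H u u-ind p uₚ∉H = conclude (∀⊎⟶⊎∀ line-meets)
      where
      open Projection a (u p) uₚ∉H
      w : Fin v → Vec N
      w = project ∘ u ∘ punchIn p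
      w⊆H : ∀ k → InHyp a (w k)
      w⊆H k = project-InHyp (u (punchIn p k))
      w⊆u : ∀ k → w k ∈Span u
      w⊆u k = project-∈Span {g = u} (∈Span-member u (punchIn p k)) (∈Span-member u p)
      w-ind : Independent w
      w-ind = independent-project a u p uₚ∉H u-ind
      H∩u⊆w : ∀ {x} → InHyp a x → x ∈Span u → x ∈Span w
      H∩u⊆w {x} x∈H x∈u = ∈Span-∷-InHyp a (u p) {w} uₚ∉H w⊆H x∈H
        (independent-spans u (u p ∷ w) (independent-∷ a (u p) {w} uₚ∉H w⊆H w-ind) (λ { zero → ∈Span-member u p ; (suc k) → w⊆u k }) x∈u)
      Meeting : Set (c ⊔ ℓ)
      Meeting = ∃ λ z → z ∈pt B⋆ × z ∈Span u × ¬ InHyp a z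
      -- The plane ⟨Q, Pᵢ⟩ meets the hyperplane ⟨u⟩; the meeting point is a point of B⋆
      -- unless it is Pᵢ, which then lies in ⟨w⟩.
      line-meets : ∀ i → Meeting ⊎ P i ∈Span w
      line-meets i = meet (plane-meets-span u u-ind Q (P i))
        where
        meet : (∃ λ s → ∃ λ t → (¬ s ≈ 0# ⊎ ¬ t ≈ 0#) × (s *ᵥ Q +ᵥ t *ᵥ P i) ∈Span u) → Meeting ⊎ P i ∈Span w
        meet (s , t , nontrivial , z∈u) = decide (s ≟0)
          where
          z : Vec N
          z = s *ᵥ Q +ᵥ t *ᵥ P i
          decide : Dec (s ≈ 0#) → Meeting ⊎ P i ∈Span w
          decide (no s≉0) = inj₁ (z , on-line⇒∈B⋆ (∉Hyp⇒IsPoint a z z∉H) z∈l (∉Hyp-≁-InHyp a z∉H (P⊆H i)) , z∈u , z∉H)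
            where
            z∉H : ¬ InHyp a z
            z∉H z∈H = *-≉0 s≉0 Q∉H (begin
              s * dot a Q                          ≈⟨ +-identityʳ _ ⟨
              s * dot a Q + 0#                     ≈⟨ +-congˡ (trans (*-congˡ (P⊆H i)) (zeroʳ t)) ⟨
              s * dot a Q + t * dot a (P i)        ≈⟨ +-cong (dot-*ᵥ a s Q) (dot-*ᵥ a t (P i)) ⟨
              dot a (s *ᵥ Q) + dot a (t *ᵥ P i)    ≈⟨ dot-+ᵥ a (s *ᵥ Q) (t *ᵥ P i) ⟨
              dot a z                               ≈⟨ z∈H ⟩
              0#                                    ∎)
            z∈l : z ∈Span l i
            z∈l = ∈Span-+ (l i) (∈Span-* s (l i) (Q∈l i)) (∈Span-* t (l i) (P∈l i))
          decide (yes s≈0) = inj₂ (H∩u⊆w (P⊆H i) (∼-∈Span u (∼-sym z∼P) z∈u))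
            where
            t≉0 : ¬ t ≈ 0#
            t≉0 t≈0 = [ (λ s≉0 → s≉0 s≈0) , (λ t≉0 → t≉0 t≈0) ]′ nontrivial
            z∼P : z ∼ P i
            z∼P = t , t≉0 , λ k → trans (+-congʳ (x≈0⇒x*y≈0 (Q k) s≈0)) (+-identityˡ _)
      conclude : Meeting ⊎ (∀ i → P i ∈Span w) → SpannedFromB⋆ u
      conclude (inj₂ P⊆w) = contradiction P⊆w (independent-⊈-smaller {y = P} w P-ind)
      conclude (inj₁ (z , z∈B⋆ , z∈u , z∉H)) = (z ∷ b) , y∈B⋆ , y⊆u , u⊆y
        where
        blocking : ∃ λ (f : Fin v → Fin (length B)) → SameSpan (λ j → lookup B (f j)) w
        blocking = B-blocking w w-ind w⊆H
        b : Fin v → Vec N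
        b = lookup B ∘ proj₁ blocking
        y∈B⋆ : ∀ j → (z ∷ b) j ∈pt B⋆
        y∈B⋆ zero    = z∈B⋆
        y∈B⋆ (suc k) = Anyₚ.++⁺ˡ (lookup-∈pt B (proj₁ blocking k))
        y⊆u : ∀ j → (z ∷ b) j ∈Span u
        y⊆u zero    = z∈u
        y⊆u (suc k) = ∈Span-trans {y = w} {g = u} (proj₁ (proj₂ blocking) k) w⊆u
        u⊆y : ∀ k → u k ∈Span (z ∷ b)
        u⊆y k = Pz.∈Span-∷-project {b = b} (∈Span-trans {y = w} {g = b}
          (H∩u⊆w (Pz.project-InHyp (u k)) (Pz.project-∈Span {g = u} (∈Span-member u k) z∈u)) (proj₂ (proj₂ blocking)))
          where module Pz = Projection a z z∉H

    spanned : ∀ u → Independent u → SpannedFromB⋆ u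
    spanned u u-ind with all? (λ k → dot a (u k) ≟0)
    ... | yes u⊆H  = spanned-in-H u u-ind u⊆H
    ... | no ¬u⊆H with ¬∀⟶∃¬ _ _ (λ k → dot a (u k) ≟0) ¬u⊆H
    ...   | p , uₚ∉H = spanned-off-H u u-ind p uₚ∉H

    B⋆-strongBlocking : StrongBlocking (suc v) B⋆
    B⋆-strongBlocking u u-ind _ = let y , y∈B⋆ , y≈u = spanned u u-ind in sameSpan-listed B⋆ u y y∈B⋆ y≈u

open import Data.Nat using (_+_; _*_; _∸_)

theorem6 : ∀ {c ℓ} (F : Field c ℓ) (q v k : ℕ) → PrimePower q → HasOrder F q → 2 ≤ v →
    let open Geometry F in
    (a : Vec (suc (suc v))) → IsPoint a →
    (B : List (Vec (suc (suc v)))) → ValidPointSet B → length B ≡ k →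
    All (InHyp a) B → StrongBlockingIn (InHyp a) v B →
    (P : Fin (suc v) → Vec (suc (suc v))) → (∀ i → IsPoint (P i)) →
    (∀ i → InHyp a (P i)) → Independent P →
    (l : Fin (suc v) → Fin 2 → Vec (suc (suc v))) → (∀ i → Independent (l i)) →
    (∃ λ Q → IsPoint Q × (∀ i → Q ∈Span l i)) →
    (∀ i x → IsPoint x → ((x ∈Span l i × InHyp a x) ⇔ x ∼ P i)) →
    ∃ λ (Bs : List (Vec (suc (suc v)))) →
      ValidPointSet Bs ×
      (∀ x → IsPoint x → (x ∈pt Bs ⇔ (x ∈pt B ⊎ ∃ λ i → x ∈Span l i × ¬ (x ∼ P i)))) ×
      StrongBlocking (suc v) Bs ×
      length Bs ≡ k + 1 + suc v * (q ∸ 1)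
theorem6 F q (suc v′) k _ order (s≤s (s≤s z≤n)) a _ B B-valid |B|≡k B⊆H B-blocking P P-point P⊆H P-ind l _
  (Q , Q-point , Q∈l) l∩H =
  B⋆ , B⋆-valid B-valid , (λ x x-point → mk⇔ (∈B⋆⇒ x) (⇒∈B⋆ x x-point)) , B⋆-strongBlocking ,
  ≡.trans length-B⋆ (≡.cong (λ n → n + 1 + suc (suc v′) * (q ∸ 1)) |B|≡k)
  where
  open Construction.Configuration F (FiniteField.hasOrder⇒≟0 F order) (FiniteField.hasOrder⇒nonzeroEnumeration F order) v′
    a B B⊆H B-blocking P P-point P⊆H P-ind l Q Q-point Q∈l l∩H
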